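{- Let $0\le k\le n-2$. An $n$-element poset $P$ has a $k$-untangled labeling if and only if $P$ has a lower order ideal of size $k+2$ that is not an antichain.
   Context: A labeling of a finite $n$-element poset $P$ is a bijection $L:P\to[n]$; a linear extension is a labeling with $L(x)\le L(y)$ whenever $x\le_P y$. A lower order ideal of $P$ is a subset $Q$ such that $x\in Q$ and $x'\le_P x$ imply $x'\in Q$. For a labeling $L$ and a non-maximal $x\in P$, the $L$-successor of $x$ is the element $y>_P x$ minimizing $L(y)$. The promotion chain of $L$ is $v_1<_P\cdots<_P v_m$, where $v_1=L^{ -1}(1)$, $v_{i+1}$ is the $L$-successor of $v_i$ as long as $v_i$ is not maximal, and $v_m$ is maximal. Extended promotion is defined by $\partial(L)(x)=L(x)-1$ if $x$ is not in the promotion chain, $\partial(L)(v_i)=L(v_{i+1})-1$ for $1\le i\le m-1$, and $\partial(L)(v_m)=n$. A labeling $L$ of an $n$-element poset is $k$-untangled if $n\ge k+2$ and $\partial^{n-k-2}(L)$ is not a linear extension. -}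

module Defs where

open import Level using (0ℓ)
open import Data.Nat using (ℕ; zero; suc; _+_; _∸_; _≤_; _<ᵇ_)
open import Data.Bool using (Bool; true; false; if_then_else_)
open import Data.Fin using (Fin; _≟_)
open import Data.Fin.Subset using (Subset; _∈_; ∣_∣)
open import Data.List using (List; foldr)
open import Data.List using () renaming (allFin to allFinL)
open import Data.Maybe using (Maybe; just; nothing; maybe)
open import Data.Product using (_×_; Σ)
open import Function using (id)
open import Function.Definitions using (Injective)
open import Relation.Nullary using (¬_; yes; no)
open import Relation.Binary.Core using (Rel)
open import Relation.Binary.Definitions using (Decidable)
open import Relation.Binary.Structures using (IsPartialOrder)
open import Relation.Binary.PropositionalEquality using (_≡_; _≢_)

record FinPoset (n : ℕ) : Set₁ where
  field
    _≤P_ : Rel (Fin n) 0ℓ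
    isPartialOrder : IsPartialOrder _≡_ _≤P_
    _≤?_ : Decidable _≤P_

  _<P_ : Rel (Fin n) 0ℓ
  x <P y = x ≤P y × x ≢ y

open FinPoset public

-- A labeling: a bijection P → [n] = {1,…,n}; given as an injective map into
-- {1,…,n} (which, on an n-element set, is the same as a bijection).
record Labeling {n : ℕ} (P : FinPoset n) : Set where
  field
    lab : Fin n → ℕ
    lab-inj : Injective _≡_ _≡_ lab
    lab-pos : ∀ x → 1 ≤ lab x
    lab-le : ∀ x → lab x ≤ n

open Labeling public

module _ {n : ℕ} (P : FinPoset n) where

  ltb : Fin n → Fin n → Bool
  ltb x y with _≤?_ P x y | x ≟ y
  ... | yes _ | no _ = true
  ... | _     | _    = false

  argminBy : (Fin n → Bool) → (Fin n → ℕ) → Maybe (Fin n)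
  argminBy ok L = foldr step nothing (allFinL n)
    where
    step : Fin n → Maybe (Fin n) → Maybe (Fin n)
    step y acc = if ok y
      then maybe (λ z → if L y <ᵇ L z then just y else just z) (just y) acc
      else acc

  successor : (Fin n → ℕ) → Fin n → Maybe (Fin n)
  successor L x = argminBy (ltb x) L

  firstElem : (Fin n → ℕ) → Maybe (Fin n)
  firstElem L = argminBy (λ y → isOne (L y)) L
    where
    isOne : ℕ → Bool
    isOne 1 = true
    isOne _ = false

  walk : (Fin n → ℕ) → ℕ → Fin n → Fin n → Maybe ℕ
  walk L zero v x = nothing
  walk L (suc fuel) v x with v ≟ x | successor L v
  ... | yes _ | just w  = just (L w ∸ 1)
  ... | yes _ | nothing = just n
  ... | no _  | just w  = walk L fuel w x
  ... | no _  | nothing = nothing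

  promotion : (Fin n → ℕ) → (Fin n → ℕ)
  promotion L x with firstElem L
  ... | nothing = L x ∸ 1
  ... | just v1 = maybe id (L x ∸ 1) (walk L n v1 x)

  iterate : ℕ → (Fin n → ℕ) → (Fin n → ℕ)
  iterate zero L = L
  iterate (suc j) L = iterate j (promotion L)

  IsLinearExtension : (Fin n → ℕ) → Set
  IsLinearExtension L = ∀ x y → _≤P_ P x y → L x ≤ L y

  Untangled : ℕ → Labeling P → Set
  Untangled k L = (k + 2 ≤ n) × ¬ IsLinearExtension (iterate (n ∸ (k + 2)) (lab L))

  IsLowerOrderIdeal : Subset n → Set
  IsLowerOrderIdeal Q = ∀ x x′ → x ∈ Q → _≤P_ P x′ x → x′ ∈ Q

  IsAntichain : Subset n → Set
  IsAntichain Q = ∀ x y → x ∈ Q → y ∈ Q → _≤P_ P x y → x ≡ y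

-- Extended promotion ∂ relabels the promotion chain v₁ < ⋯ < v_m by L(v_{i+1}) − 1 and n, and every
-- other element x by L(x) − 1. If L is order-preserving on the elements whose label exceeds m + 1,
-- then ∂L is order-preserving on those whose label exceeds m; every labeling is trivially so above n,
-- hence M = ∂^(n−c) L is order-preserving above c = k + 2. An inversion x ≤ y, M y < M x of M thus
-- has M x ≤ c, and the elements labelled ≤ c form a lower ideal of size c containing x < y.
-- Conversely, the chain starts at label 1 and moves upwards, so it never enters a lower ideal Q whose
-- labels all exceed 1, and ∂ merely lowers the labels on Q by one. Given a < b in Q, label the
-- complement of Q first, then b, then the rest of Q; after n − c promotions b carries label 1 and a
-- a larger one.
module Submission where

open import Defs hiding (_≤?_; _≤P_; _<P_; isPartialOrder)
open import Data.Bool using (Bool; true; false; if_then_else_)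
open import Data.Fin using (Fin; toℕ)
import Data.Fin as Fin
open import Data.Fin.Properties using (any?; all?; ¬∀⟶∃¬; toℕ<n; toℕ-injective)
open import Data.Fin.Subset using (Subset; _∈_; _∉_; _⊆_; _∪_; ∁; ⊥; ⁅_⁆; ∣_∣; inside; outside)
open import Data.Fin.Subset.Properties
  using ( p⊆q⇒∣p∣≤∣q∣; p⊂q⇒∣p∣<∣q∣; ∣⊥∣≡0; ∣⊤∣≡n; ∣⁅x⁆∣≡1; ∈⊤; x∈⁅x⁆; x∈p∪q⁺; x∈∁p⇒x∉p
        ; ∣∁p∣≡n∸∣p∣; ∣p∣≤n; ∣p∣≤∣x∷p∣; x∈p⇒∣p-x∣<∣p∣; _∈?_ )
open import Data.List using (List; []; _∷_; foldr) renaming (allFin to allFinL)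
open import Data.List.Membership.Propositional using () renaming (_∈_ to _∈L_)
open import Data.List.Membership.Propositional.Properties using (∈-allFin)
open import Data.List.Relation.Unary.Any using (here; there)
open import Data.Maybe using (Maybe; just; nothing; maybe)
open import Data.Nat using (ℕ; zero; suc; _+_; _*_; _∸_; _≤_; _<_; z≤n; s≤s; z<s; _<ᵇ_)
open import Data.Nat.Properties
open import Data.Product using (Σ; _×_; _,_; ∃; ∃₂; proj₁; proj₂; map₁)
open import Data.Sum using (_⊎_; inj₁; inj₂)
open import Data.Vec using ([]; _∷_; tabulate)
open import Data.Vec.Properties using (lookup∘tabulate; []=⇒lookup; lookup⇒[]=)
open import Function using (_∘_)
open import Function.Bundles using (_⇔_; mk⇔)
open import Function.Definitions using (Injective)
open import Level using (Level)
open import Relation.Binary.Definitions using (tri<; tri≈; tri>)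
open import Relation.Binary.PropositionalEquality using (_≡_; _≢_; refl; sym; trans; cong; subst; module ≡-Reasoning)
open import Relation.Binary.Structures using (IsPartialOrder)
open import Relation.Nullary using (¬_; Dec; yes; no; does; contradiction)
open import Relation.Nullary.Decidable using (dec-true; _→-dec_; _×-dec_)
open import Relation.Nullary.Reflects using (ofʸ; ofⁿ)
open import Relation.Unary using (Pred; Decidable)

private
  variable
    ℓ : Level
    n : ℕ

<∸1⇒1+< : ∀ {a b} → a < b ∸ 1 → suc a < b
<∸1⇒1+< {b = suc b} a<b = s≤s a<b

1+<⇒<∸1 : ∀ {a b} → suc a < b → a < b ∸ 1
1+<⇒<∸1 (s≤s a<b) = a<b

¬∀⇒∃¬₂ : ∀ {a b} {A : Fin n → Fin n → Set a} {B : Fin n → Fin n → Set b} →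
  (∀ x y → Dec (A x y)) → (∀ x y → Dec (B x y)) →
  ¬ (∀ x y → A x y → B x y) → ∃₂ λ x y → A x y × ¬ B x y
¬∀⇒∃¬₂ {n} A? B? ¬∀ with ¬∀⟶∃¬ n _ (λ x → all? λ y → A? x y →-dec B? x y) ¬∀
... | x , ¬∀y with ¬∀⟶∃¬ n _ (λ y → A? x y →-dec B? x y) ¬∀y
...   | y , ¬A⇒B with A? x y
...     | yes a = x , y , a , λ b → ¬A⇒B λ _ → b
...     | no ¬a = contradiction (λ a → contradiction a ¬a) ¬A⇒B

subset : {P : Pred (Fin n) ℓ} → Decidable P → Subset n
subset P? = tabulate (does ∘ P?)

module _ {P : Pred (Fin n) ℓ} (P? : Decidable P) where

  ∈-subset⁺ : ∀ {x} → P x → x ∈ subset P?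
  ∈-subset⁺ {x} px = lookup⇒[]= x _ (trans (lookup∘tabulate _ x) (dec-true (P? x) px))

  ∈-subset⁻ : ∀ {x} → x ∈ subset P? → P x
  ∈-subset⁻ {x} x∈ with P? x | trans (sym (lookup∘tabulate (does ∘ P?) x)) ([]=⇒lookup x∈)
  ... | yes px | _ = px
  ... | no _   | ()

∣p∪q∣≤∣p∣+∣q∣ : (p q : Subset n) → ∣ p ∪ q ∣ ≤ ∣ p ∣ + ∣ q ∣
∣p∪q∣≤∣p∣+∣q∣ []            []            = z≤n
∣p∪q∣≤∣p∣+∣q∣ (inside  ∷ p) (s       ∷ q) =
  s≤s (≤-trans (∣p∪q∣≤∣p∣+∣q∣ p q) (+-monoʳ-≤ ∣ p ∣ (∣p∣≤∣x∷p∣ s q)))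
∣p∪q∣≤∣p∣+∣q∣ (outside ∷ p) (inside  ∷ q) =
  ≤-trans (s≤s (∣p∪q∣≤∣p∣+∣q∣ p q)) (≤-reflexive (sym (+-suc ∣ p ∣ ∣ q ∣)))
∣p∪q∣≤∣p∣+∣q∣ (outside ∷ p) (outside ∷ q) = ∣p∪q∣≤∣p∣+∣q∣ p q

module _ {f : Fin n → ℕ} (f-inj : Injective _≡_ _≡_ f) where

  private
    below : ℕ → Subset n
    below m = subset (λ z → f z <? m)

  ∣f<m∣≤m : ∀ m → ∣ below m ∣ ≤ m
  ∣f<m∣≤m zero = ≤-trans (p⊆q⇒∣p∣≤∣q∣ {q = ⊥} λ z∈ → contradiction (∈-subset⁻ (λ z → f z <? 0) z∈) n≮0)
                         (≤-reflexive (∣⊥∣≡0 n))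
  ∣f<m∣≤m (suc m) with any? (λ x → f x ≟ m)
  ... | yes (x , fx≡m) = begin
    ∣ below (suc m) ∣             ≤⟨ p⊆q⇒∣p∣≤∣q∣ below-suc ⟩
    ∣ below m ∪ ⁅ x ⁆ ∣           ≤⟨ ∣p∪q∣≤∣p∣+∣q∣ (below m) ⁅ x ⁆ ⟩
    ∣ below m ∣ + ∣ ⁅ x ⁆ ∣       ≤⟨ +-mono-≤ (∣f<m∣≤m m) (≤-reflexive (∣⁅x⁆∣≡1 x)) ⟩
    m + 1                         ≡⟨ +-comm m 1 ⟩
    suc m                         ∎
    where
    open ≤-Reasoning
    below-suc : below (suc m) ⊆ below m ∪ ⁅ x ⁆
    below-suc {z} z∈ with m<1+n⇒m<n∨m≡n (∈-subset⁻ (λ z → f z <? suc m) z∈)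
    ... | inj₁ fz<m = x∈p∪q⁺ (inj₁ (∈-subset⁺ (λ z → f z <? m) fz<m))
    ... | inj₂ fz≡m with f-inj {z} {x} (trans fz≡m (sym fx≡m))
    ...   | refl = x∈p∪q⁺ (inj₂ (x∈⁅x⁆ z))
  ... | no ∄x = m≤n⇒m≤1+n (≤-trans (p⊆q⇒∣p∣≤∣q∣ below-suc) (∣f<m∣≤m m))
    where
    below-suc : below (suc m) ⊆ below m
    below-suc {z} z∈ with m<1+n⇒m<n∨m≡n (∈-subset⁻ (λ z → f z <? suc m) z∈)
    ... | inj₁ fz<m = ∈-subset⁺ (λ z → f z <? m) fz<m
    ... | inj₂ fz≡m = contradiction (z , fz≡m) ∄x

  injective-bounded⇒∣p∣≤m : ∀ {p : Subset n} {m} → (∀ {z} → z ∈ p → f z < m) → ∣ p ∣ ≤ m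
  injective-bounded⇒∣p∣≤m {m = m} bound =
    ≤-trans (p⊆q⇒∣p∣≤∣q∣ (∈-subset⁺ (λ z → f z <? m) ∘ bound)) (∣f<m∣≤m m)

module _ {P : FinPoset n} (L : Labeling P) where

  ∸1-injective : Injective _≡_ _≡_ (λ z → lab L z ∸ 1)
  ∸1-injective {x} {y} eq = lab-inj L (∸-cancelʳ-≡ (lab-pos L x) (lab-pos L y) eq)

  n∸-injective : Injective _≡_ _≡_ (λ z → n ∸ lab L z)
  n∸-injective {x} {y} eq = lab-inj L (∸-cancelˡ-≡ (lab-le L x) (lab-le L y) eq)

  ∣labels≤c∣≡c : ∀ {c} → c ≤ n → ∣ subset (λ z → lab L z ≤? c) ∣ ≡ c
  ∣labels≤c∣≡c {c} c≤n = ≤-antisym ∣A∣≤c c≤∣A∣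
    where
    A = subset (λ z → lab L z ≤? c)
    ∣A∣≤c : ∣ A ∣ ≤ c
    ∣A∣≤c = injective-bounded⇒∣p∣≤m ∸1-injective λ {z} z∈A →
      ∸-monoˡ-< (s≤s (∈-subset⁻ (λ z → lab L z ≤? c) z∈A)) (lab-pos L z)
    ∣∁A∣≤n∸c : ∣ ∁ A ∣ ≤ n ∸ c
    ∣∁A∣≤n∸c = injective-bounded⇒∣p∣≤m n∸-injective λ {z} z∈∁A →
      ∸-monoʳ-< (≰⇒> (x∈∁p⇒x∉p z∈∁A ∘ ∈-subset⁺ (λ z → lab L z ≤? c))) (lab-le L z)
    c≤∣A∣ : c ≤ ∣ A ∣
    c≤∣A∣ = ∸-cancelʳ-≤ c≤n (subst (_≤ n ∸ c) (∣∁p∣≡n∸∣p∣ A) ∣∁A∣≤n∸c)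

module _ (key : Fin n → ℕ) where

  keysBelow : Fin n → Subset n
  keysBelow z = subset (λ w → key w <? key z)

  rank : Fin n → ℕ
  rank z = suc ∣ keysBelow z ∣

  ∉keysBelow : ∀ z → z ∉ keysBelow z
  ∉keysBelow z z∈ = <-irrefl refl (∈-subset⁻ (λ w → key w <? key z) z∈)

  rank-mono : ∀ {z w} → key z < key w → rank z < rank w
  rank-mono {z} {w} z<w = s≤s (p⊂q⇒∣p∣<∣q∣ (below⊆ , z , ∈-subset⁺ (λ v → key v <? key w) z<w , ∉keysBelow z))
    where
    below⊆ : keysBelow z ⊆ keysBelow w
    below⊆ v∈ = ∈-subset⁺ (λ v → key v <? key w) (<-trans (∈-subset⁻ (λ v → key v <? key z) v∈) z<w)

  rank≤n : ∀ z → rank z ≤ n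
  rank≤n z = subst (rank z ≤_) (∣⊤∣≡n n) (p⊂q⇒∣p∣<∣q∣ ((λ _ → ∈⊤) , z , ∈⊤ , ∉keysBelow z))

  rank-injective : Injective _≡_ _≡_ key → Injective _≡_ _≡_ rank
  rank-injective key-inj {z} {w} eq with <-cmp (key z) (key w)
  ... | tri< z<w _ _ = contradiction eq (<⇒≢ (rank-mono z<w))
  ... | tri≈ _ z≡w _ = key-inj z≡w
  ... | tri> _ _ w<z = contradiction (sym eq) (<⇒≢ (rank-mono w<z))

rankLabeling : {P : FinPoset n} (key : Fin n → ℕ) → Injective _≡_ _≡_ key → Labeling P
rankLabeling key key-inj = record
  { lab = rank key
  ; lab-inj = rank-injective key key-inj
  ; lab-pos = λ _ → s≤s z≤n
  ; lab-le = rank≤n key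
  }

module _ (tier : Fin n → ℕ) where

  tieredKey : Fin n → ℕ
  tieredKey z = tier z * n + toℕ z

  tieredKey-mono : ∀ {z w} → tier z < tier w → tieredKey z < tieredKey w
  tieredKey-mono {z} {w} tz<tw = begin-strict
    tier z * n + toℕ z  <⟨ +-monoʳ-< (tier z * n) (toℕ<n z) ⟩
    tier z * n + n      ≡⟨ +-comm (tier z * n) n ⟩
    suc (tier z) * n    ≤⟨ *-monoˡ-≤ n tz<tw ⟩
    tier w * n          ≤⟨ m≤m+n (tier w * n) (toℕ w) ⟩
    tier w * n + toℕ w  ∎
    where open ≤-Reasoning

  tieredKey-injective : Injective _≡_ _≡_ tieredKey
  tieredKey-injective {z} {w} eq with <-cmp (tier z) (tier w)
  ... | tri< tz<tw _ _ = contradiction eq (<⇒≢ (tieredKey-mono tz<tw))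
  ... | tri> _ _ tw<tz = contradiction (sym eq) (<⇒≢ (tieredKey-mono tw<tz))
  ... | tri≈ _ tz≡tw _ =
    toℕ-injective (+-cancelˡ-≡ (tier z * n) (toℕ z) (toℕ w) (trans eq (cong (λ t → t * n + toℕ w) (sym tz≡tw))))

module _ (Q : Subset n) (b : Fin n) where

  tier : Fin n → ℕ
  tier z with z ∈? Q | z Fin.≟ b
  ... | no _  | _     = 0
  ... | yes _ | yes _ = 1
  ... | yes _ | no _  = 2

  tier-outside : ∀ {z} → z ∉ Q → tier z ≡ 0
  tier-outside {z} z∉Q with z ∈? Q
  ... | no _    = refl
  ... | yes z∈Q = contradiction z∈Q z∉Q

  tier-inside : ∀ {z} → z ∈ Q → 0 < tier z
  tier-inside {z} z∈Q with z ∈? Q | z Fin.≟ b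
  ... | no z∉Q | _     = contradiction z∈Q z∉Q
  ... | yes _  | yes _ = z<s
  ... | yes _  | no _  = z<s

  tier-b<tier : ∀ {a} → a ∈ Q → b ∈ Q → a ≢ b → tier b < tier a
  tier-b<tier {a} a∈Q b∈Q a≢b with b ∈? Q | b Fin.≟ b | a ∈? Q | a Fin.≟ b
  ... | yes _ | yes _ | yes _ | no _    = s≤s (s≤s z≤n)
  ... | no b∉Q | _    | _     | _       = contradiction b∈Q b∉Q
  ... | yes _ | no b≢b | _    | _       = contradiction refl b≢b
  ... | yes _ | yes _ | no a∉Q | _      = contradiction a∈Q a∉Q
  ... | yes _ | yes _ | yes _ | yes a≡b = contradiction a≡b a≢b

module _ (P : FinPoset n) where

  open FinPoset P using (_≤P_; _<P_; isPartialOrder) renaming (_≤?_ to _≤P?_)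
  open IsPartialOrder isPartialOrder using () renaming (refl to ≤P-refl; trans to ≤P-trans; antisym to ≤P-antisym)

  module _ (ok : Fin n → Bool) (L : Fin n → ℕ) where

    -- The step function of argminBy in Defs is local to it; this copy is definitionally equal,
    -- so argminBy P ok L unfolds to foldr argminStep nothing (allFinL n).
    argminStep : Fin n → Maybe (Fin n) → Maybe (Fin n)
    argminStep y acc = if ok y
      then maybe (λ z → if L y <ᵇ L z then just y else just z) (just y) acc
      else acc

    data ArgminOf (xs : List (Fin n)) : Maybe (Fin n) → Set where
      none : (∀ {z} → z ∈L xs → ok z ≡ false) → ArgminOf xs nothing
      some : ∀ {y} → ok y ≡ true → (∀ {z} → z ∈L xs → ok z ≡ true → L y ≤ L z) → ArgminOf xs (just y)

    argminStep-correct : ∀ x {xs acc} → ArgminOf xs acc → ArgminOf (x ∷ xs) (argminStep x acc)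
    argminStep-correct x r with ok x in okx
    argminStep-correct x (none ¬ok) | false = none λ { (here refl) → okx ; (there z∈) → ¬ok z∈ }
    argminStep-correct x (some oky min) | false = some oky λ
      { (here refl) okz → contradiction (trans (sym okx) okz) λ ()
      ; (there z∈) → min z∈ }
    argminStep-correct x (none ¬ok) | true = some okx λ
      { (here refl) _ → ≤-refl
      ; (there z∈) okz → contradiction (trans (sym (¬ok z∈)) okz) λ () }
    argminStep-correct x (some {y} oky min) | true with L x <ᵇ L y | <ᵇ-reflects-< (L x) (L y)
    ... | true  | ofʸ x<y = some okx λ
      { (here refl) _ → ≤-refl
      ; (there z∈) okz → ≤-trans (<⇒≤ x<y) (min z∈ okz) }
    ... | false | ofⁿ x≮y = some oky λ
      { (here refl) _ → ≮⇒≥ x≮y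
      ; (there z∈) → min z∈ }

    foldr-argmin : ∀ xs → ArgminOf xs (foldr argminStep nothing xs)
    foldr-argmin []       = none λ ()
    foldr-argmin (x ∷ xs) = argminStep-correct x (foldr-argmin xs)

    argminBy-just : ∀ {y} → argminBy P ok L ≡ just y → ok y ≡ true × (∀ z → ok z ≡ true → L y ≤ L z)
    argminBy-just eq with argminBy P ok L | foldr-argmin (allFinL n)
    argminBy-just refl | just y | some oky min = oky , λ z → min (∈-allFin z)

    argminBy-nothing : argminBy P ok L ≡ nothing → ∀ z → ok z ≡ false
    argminBy-nothing eq with argminBy P ok L | foldr-argmin (allFinL n)
    argminBy-nothing refl | nothing | none ¬ok = λ z → ¬ok (∈-allFin z)

  ltb⇒<P : ∀ {x y} → ltb P x y ≡ true → x <P y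
  ltb⇒<P {x} {y} eq with x ≤P? y | x Fin.≟ y
  ltb⇒<P refl | yes x≤y | no x≢y = x≤y , x≢y

  <P⇒ltb : ∀ {x y} → x <P y → ltb P x y ≡ true
  <P⇒ltb {x} {y} (x≤y , x≢y) with x ≤P? y | x Fin.≟ y
  ... | yes _   | no _    = refl
  ... | yes _   | yes x≡y = contradiction x≡y x≢y
  ... | no x≰y  | _       = contradiction x≤y x≰y

  module _ (L : Fin n → ℕ) where

    successor-just : ∀ {x w} → successor P L x ≡ just w → x <P w × (∀ z → x <P z → L w ≤ L z)
    successor-just eq with argminBy-just (ltb P _) L eq
    ... | x<w , min = ltb⇒<P x<w , λ z → min z ∘ <P⇒ltb

    successor-nothing : ∀ {x} → successor P L x ≡ nothing → ∀ {z} → x ≤P z → x ≡ z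
    successor-nothing {x} eq {z} x≤z with x Fin.≟ z
    ... | yes x≡z = x≡z
    ... | no x≢z  = contradiction (trans (sym (<P⇒ltb (x≤z , x≢z))) (argminBy-nothing (ltb P x) L eq z)) λ ()

    firstElem-just : ∀ {v} → firstElem P L ≡ just v → L v ≡ 1
    firstElem-just {v} eq with L v | proj₁ (argminBy-just _ L eq)
    ... | 1 | _ = refl

    firstElem-nothing : firstElem P L ≡ nothing → ∀ z → L z ≢ 1
    firstElem-nothing eq z Lz≡1 with L z | argminBy-nothing _ L eq z
    ... | 1 | ()

    data SuccPath : Fin n → Fin n → Set where
      []  : ∀ {v} → SuccPath v v
      _∷_ : ∀ {v w x} → successor P L v ≡ just w → SuccPath w x → SuccPath v x

    SuccPath⇒≤P : ∀ {v x} → SuccPath v x → v ≤P x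
    SuccPath⇒≤P []      = ≤P-refl
    SuccPath⇒≤P (s ∷ p) = ≤P-trans (proj₁ (proj₁ (successor-just s))) (SuccPath⇒≤P p)

    SuccPath-snoc : ∀ {v x y} → SuccPath v x → successor P L x ≡ just y → SuccPath v y
    SuccPath-snoc []      s′ = s′ ∷ []
    SuccPath-snoc (s ∷ p) s′ = s ∷ SuccPath-snoc p s′

    SuccPath-total : ∀ {v x y} → SuccPath v x → SuccPath v y → SuccPath x y ⊎ SuccPath y x
    SuccPath-total []      q        = inj₁ q
    SuccPath-total (s ∷ p) []       = inj₂ (s ∷ p)
    SuccPath-total (s ∷ p) (s′ ∷ q) with trans (sym s) s′
    ... | refl = SuccPath-total p q

    SuccPath-from-maximal : ∀ {x y} → SuccPath x y → successor P L x ≡ nothing → x ≡ y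
    SuccPath-from-maximal []      _  = refl
    SuccPath-from-maximal (s ∷ _) s′ with trans (sym s) s′
    ... | ()

    SuccPath-same-successor : ∀ {x y w} → SuccPath x y → successor P L x ≡ just w → successor P L y ≡ just w → x ≡ y
    SuccPath-same-successor []      _  _  = refl
    SuccPath-same-successor (s ∷ p) sx sy with trans (sym s) sx
    ... | refl = contradiction (≤P-antisym y≤w (SuccPath⇒≤P p)) y≢w
      where
      y≤w = proj₁ (proj₁ (successor-just sy))
      y≢w = proj₂ (proj₁ (successor-just sy))

    chainLabel : Fin n → ℕ
    chainLabel x = maybe (λ w → L w ∸ 1) n (successor P L x)

    walk-sound : ∀ f {v x r} → walk P L f v x ≡ just r → SuccPath v x × r ≡ chainLabel x
    walk-sound (suc f) {v} {x} eq with v Fin.≟ x | successor P L v in s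
    walk-sound (suc f) refl | yes refl | just w  = [] , cong (maybe _ n) (sym s)
    walk-sound (suc f) refl | yes refl | nothing = [] , cong (maybe _ n) (sym s)
    walk-sound (suc f) eq   | no _     | just w  = map₁ (s ∷_) (walk-sound f eq)

    upSet : Fin n → Subset n
    upSet v = subset (v ≤P?_)

    ∣upSet∣-decreasing : ∀ {v w} → successor P L v ≡ just w → ∣ upSet w ∣ < ∣ upSet v ∣
    ∣upSet∣-decreasing {v} {w} s = p⊂q⇒∣p∣<∣q∣ (up-w⊆up-v , v , ∈-subset⁺ (v ≤P?_) ≤P-refl , v∉up-w)
      where
      v<w = proj₁ (successor-just s)
      up-w⊆up-v : upSet w ⊆ upSet v
      up-w⊆up-v z∈ = ∈-subset⁺ (v ≤P?_) (≤P-trans (proj₁ v<w) (∈-subset⁻ (w ≤P?_) z∈))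
      v∉up-w : v ∉ upSet w
      v∉up-w v∈ = proj₂ v<w (≤P-antisym (proj₁ v<w) (∈-subset⁻ (w ≤P?_) v∈))

    walk-complete : ∀ f {v x} → SuccPath v x → ∣ upSet v ∣ ≤ f → ∃ λ r → walk P L f v x ≡ just r
    walk-complete zero {v} _ bound =
      contradiction (≤-trans (≤-<-trans z≤n (x∈p⇒∣p-x∣<∣p∣ (∈-subset⁺ (v ≤P?_) ≤P-refl))) bound) λ ()
    walk-complete (suc f) {v} {x} p bound with v Fin.≟ x | successor P L v in s | p
    ... | yes _   | just _  | _      = _ , refl
    ... | yes _   | nothing | _      = _ , refl
    ... | no v≢x  | _       | []     = contradiction refl v≢x
    ... | no _    | nothing | s′ ∷ _ = contradiction (trans (sym s′) s) λ ()
    ... | no _    | just w  | s′ ∷ q with trans (sym s′) s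
    ...   | refl = walk-complete f q (≤-pred (≤-trans (∣upSet∣-decreasing s) bound))

    OnChain : Fin n → Set
    OnChain x = ∃ λ v₁ → firstElem P L ≡ just v₁ × SuccPath v₁ x

    data PromotionView (x : Fin n) : Set where
      off-chain  : ¬ OnChain x → promotion P L x ≡ L x ∸ 1 → PromotionView x
      chain-step : ∀ {w} → OnChain x → successor P L x ≡ just w → promotion P L x ≡ L w ∸ 1 → PromotionView x
      chain-top  : OnChain x → successor P L x ≡ nothing → promotion P L x ≡ n → PromotionView x

    promotion-off-chain : ∀ {x} → ¬ OnChain x → promotion P L x ≡ L x ∸ 1
    promotion-off-chain {x} ¬on with firstElem P L
    ... | nothing = refl
    ... | just v₁ with walk P L n v₁ x in w
    ...   | just _  = contradiction (v₁ , refl , proj₁ (walk-sound n w)) ¬on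
    ...   | nothing = refl

    promotion-on-chain : ∀ {x} → OnChain x → promotion P L x ≡ chainLabel x
    promotion-on-chain {x} (v₁ , first , p) with firstElem P L | first
    ... | just _ | refl with walk-complete n p (∣p∣≤n (upSet v₁))
    ...   | r , w rewrite w = proj₂ (walk-sound n w)

    onChain? : ∀ x → Dec (OnChain x)
    onChain? x with firstElem P L
    ... | nothing = no λ { (_ , () , _) }
    ... | just v₁ with walk P L n v₁ x in w
    ...   | just _  = yes (v₁ , refl , proj₁ (walk-sound n w))
    ...   | nothing = no λ { (_ , refl , p) → walk-lost p }
      where
      walk-lost : ¬ SuccPath v₁ x
      walk-lost p with walk-complete n p (∣p∣≤n (upSet v₁))
      ... | _ , w′ = contradiction (trans (sym w) w′) λ ()

    promotion-view : ∀ x → PromotionView x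
    promotion-view x with onChain? x
    ... | no ¬on = off-chain ¬on (promotion-off-chain ¬on)
    ... | yes on with successor P L x in s
    ...   | just w  = chain-step on s (trans (promotion-on-chain on) (cong (maybe _ n) s))
    ...   | nothing = chain-top on s (trans (promotion-on-chain on) (cong (maybe _ n) s))

    OnChain-total : ∀ {x y} → OnChain x → OnChain y → SuccPath x y ⊎ SuccPath y x
    OnChain-total (_ , first , p) (_ , first′ , q) with trans (sym first) first′
    ... | refl = SuccPath-total p q

    OnChain-successor-injective : ∀ {x y w} → OnChain x → OnChain y →
      successor P L x ≡ just w → successor P L y ≡ just w → x ≡ y
    OnChain-successor-injective onx ony sx sy with OnChain-total onx ony
    ... | inj₁ p = SuccPath-same-successor p sx sy
    ... | inj₂ p = sym (SuccPath-same-successor p sy sx)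

    OnChain-maximal-unique : ∀ {x y} → OnChain x → OnChain y →
      successor P L x ≡ nothing → successor P L y ≡ nothing → x ≡ y
    OnChain-maximal-unique onx ony sx sy with OnChain-total onx ony
    ... | inj₁ p = SuccPath-from-maximal p sx
    ... | inj₂ p = sym (SuccPath-from-maximal p sy)

    OnChain-snoc : ∀ {x w} → OnChain x → successor P L x ≡ just w → OnChain w
    OnChain-snoc (v₁ , first , p) s = v₁ , first , SuccPath-snoc p s

  module _ (L : Labeling P) where

    private
      M = lab L

    label≡1⇒OnChain : ∀ {x} → M x ≡ 1 → OnChain M x
    label≡1⇒OnChain {x} Mx≡1 with firstElem P M in first
    ... | nothing = contradiction Mx≡1 (firstElem-nothing M first x)
    ... | just v₁ = v₁ , refl , subst (SuccPath M v₁) (lab-inj L (trans (firstElem-just M first) (sym Mx≡1))) []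

    off-chain-label>1 : ∀ {x} → ¬ OnChain M x → 1 < M x
    off-chain-label>1 {x} ¬on = ≤∧≢⇒< (lab-pos L x) (¬on ∘ label≡1⇒OnChain ∘ sym)

    successor-on-chain-label>1 : ∀ {x w} → OnChain M x → successor P M x ≡ just w → 1 < M w
    successor-on-chain-label>1 {x} {w} (v₁ , first , p) s = ≤∧≢⇒< (lab-pos L w) λ 1≡Mw →
      let w≡v₁ = lab-inj L (trans (sym 1≡Mw) (sym (firstElem-just M first)))
          x<w = proj₁ (successor-just M s)
      in proj₂ x<w (≤P-antisym (proj₁ x<w) (subst (_≤P x) (sym w≡v₁) (SuccPath⇒≤P M p)))

    label∸1<n : ∀ x → M x ∸ 1 < n
    label∸1<n x = ∸-monoˡ-< (s≤s (lab-le L x)) (lab-pos L x)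

    promotion-pos : ∀ x → 1 ≤ promotion P M x
    promotion-pos x with promotion-view M x
    ... | off-chain ¬on eq    = subst (1 ≤_) (sym eq) (∸-monoˡ-≤ 1 (off-chain-label>1 ¬on))
    ... | chain-step on s eq  = subst (1 ≤_) (sym eq) (∸-monoˡ-≤ 1 (successor-on-chain-label>1 on s))
    ... | chain-top _ _ eq    = subst (1 ≤_) (sym eq) (≤-trans (lab-pos L x) (lab-le L x))

    promotion-≤n : ∀ x → promotion P M x ≤ n
    promotion-≤n x with promotion-view M x
    ... | off-chain _ eq      = subst (_≤ n) (sym eq) (<⇒≤ (label∸1<n x))
    ... | chain-step {w} _ _ eq = subst (_≤ n) (sym eq) (<⇒≤ (label∸1<n w))
    ... | chain-top _ _ eq    = ≤-reflexive eq

    promotion-injective : Injective _≡_ _≡_ (promotion P M)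
    promotion-injective {x} {y} eq with promotion-view M x | promotion-view M y
    promotion-injective {x} {y} eq | off-chain _ ex | off-chain _ ey = ∸1-injective L (trans (sym ex) (trans eq ey))
    promotion-injective {x} {y} eq | off-chain ¬onx ex | chain-step ony sy ey
      with ∸1-injective L (trans (sym ex) (trans eq ey))
    ...   | refl = contradiction (OnChain-snoc M ony sy) ¬onx
    promotion-injective {x} {y} eq | chain-step onx sx ex | off-chain ¬ony ey
      with ∸1-injective L (trans (sym ey) (trans (sym eq) ex))
    ...   | refl = contradiction (OnChain-snoc M onx sx) ¬ony
    promotion-injective {x} {y} eq | chain-step onx sx ex | chain-step ony sy ey
      with ∸1-injective L (trans (sym ex) (trans eq ey))
    ...   | refl = OnChain-successor-injective M onx ony sx sy
    promotion-injective {x} {y} eq | chain-top onx sx ex | chain-top ony sy ey = OnChain-maximal-unique M onx ony sx sy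
    promotion-injective {x} {y} eq | off-chain _ ex | chain-top _ _ ey =
      contradiction (trans (sym ex) (trans eq ey)) (<⇒≢ (label∸1<n x))
    promotion-injective {x} {y} eq | chain-top _ _ ex | off-chain _ ey =
      contradiction (trans (sym ey) (trans (sym eq) ex)) (<⇒≢ (label∸1<n y))
    promotion-injective {x} {y} eq | chain-step {w} _ _ ex | chain-top _ _ ey =
      contradiction (trans (sym ex) (trans eq ey)) (<⇒≢ (label∸1<n w))
    promotion-injective {x} {y} eq | chain-top _ _ ex | chain-step {w} _ _ ey =
      contradiction (trans (sym ey) (trans (sym eq) ex)) (<⇒≢ (label∸1<n w))

  promote : Labeling P → Labeling P
  promote L = record
    { lab = promotion P (lab L)
    ; lab-inj = promotion-injective L
    ; lab-pos = promotion-pos L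
    ; lab-le = promotion-≤n L
    }

  SortedAbove : ℕ → (Fin n → ℕ) → Set
  SortedAbove m M = ∀ {x y} → x ≤P y → m < M x → M x ≤ M y

  labeling-sortedAbove-n : (L : Labeling P) → SortedAbove n (lab L)
  labeling-sortedAbove-n L {x} _ n<Lx = contradiction (lab-le L x) (<⇒≱ n<Lx)

  module _ {m} (L : Labeling P) (sorted : SortedAbove (suc m) (lab L)) where

    private
      M = lab L

    promotion-lower-bound : ∀ {y} → suc m < M y → M y ∸ 1 ≤ promotion P M y
    promotion-lower-bound {y} m+1<My with promotion-view M y
    ... | off-chain _ eq    = ≤-reflexive (sym eq)
    ... | chain-step _ s eq =
      subst (M y ∸ 1 ≤_) (sym eq) (∸-monoˡ-≤ 1 (sorted (proj₁ (proj₁ (successor-just M s))) m+1<My))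
    ... | chain-top _ _ eq  = subst (M y ∸ 1 ≤_) (sym eq) (≤-trans (m∸n≤m (M y) 1) (lab-le L y))

    shifted-label-mono : ∀ {x u y} → promotion P M x ≡ M u ∸ 1 → m < promotion P M x → M u ≤ M y →
      promotion P M x ≤ promotion P M y
    shifted-label-mono {x} {u} {y} eq m<M′x Mu≤My = begin
      promotion P M x  ≡⟨ eq ⟩
      M u ∸ 1          ≤⟨ ∸-monoˡ-≤ 1 Mu≤My ⟩
      M y ∸ 1          ≤⟨ promotion-lower-bound (<-≤-trans (<∸1⇒1+< (subst (m <_) eq m<M′x)) Mu≤My) ⟩
      promotion P M y  ∎
      where open ≤-Reasoning

    promotion-sortedAbove : SortedAbove m (lab (promote L))
    promotion-sortedAbove {x} {y} x≤y m<M′x with x Fin.≟ y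
    ... | yes refl = ≤-refl
    ... | no x≢y with promotion-view M x
    ...   | off-chain _ eq =
      shifted-label-mono eq m<M′x (sorted x≤y (<∸1⇒1+< (subst (m <_) eq m<M′x)))
    ...   | chain-step _ s eq =
      shifted-label-mono eq m<M′x (proj₂ (successor-just M s) y (x≤y , x≢y))
    ...   | chain-top _ s _ = contradiction (successor-nothing M s x≤y) x≢y

  promoteⁿ : ℕ → Labeling P → Labeling P
  promoteⁿ zero    L = L
  promoteⁿ (suc j) L = promoteⁿ j (promote L)

  lab-promoteⁿ : ∀ j L → lab (promoteⁿ j L) ≡ iterate P j (lab L)
  lab-promoteⁿ zero    L = refl
  lab-promoteⁿ (suc j) L = lab-promoteⁿ j (promote L)

  promoteⁿ-sortedAbove : ∀ j {m} L → SortedAbove (j + m) (lab L) → SortedAbove m (lab (promoteⁿ j L))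
  promoteⁿ-sortedAbove zero    L sorted = sorted
  promoteⁿ-sortedAbove (suc j) L sorted = promoteⁿ-sortedAbove j (promote L) (promotion-sortedAbove L sorted)

  module _ {Q : Subset n} (Q-lower : IsLowerOrderIdeal P Q) where

    lower-ideal-off-chain : ∀ {L z} → (∀ {w} → w ∈ Q → 1 < L w) → z ∈ Q → ¬ OnChain L z
    lower-ideal-off-chain {L} {z} labels>1 z∈Q (v₁ , first , p) =
      <⇒≢ (labels>1 (Q-lower z v₁ z∈Q (SuccPath⇒≤P L p))) (sym (firstElem-just L first))

    iterate-on-lower-ideal : ∀ t {L} → (∀ {w} → w ∈ Q → t < L w) → ∀ {z} → z ∈ Q → iterate P t L z ≡ L z ∸ t
    iterate-on-lower-ideal zero    _ _ = refl
    iterate-on-lower-ideal (suc t) {L} labels>t {z} z∈Q = begin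
      iterate P t (promotion P L) z  ≡⟨ iterate-on-lower-ideal t shifted>t z∈Q ⟩
      promotion P L z ∸ t            ≡⟨ cong (_∸ t) (shifted z∈Q) ⟩
      L z ∸ 1 ∸ t                    ≡⟨ ∸-+-assoc (L z) 1 t ⟩
      L z ∸ suc t                    ∎
      where
      open ≡-Reasoning
      shifted : ∀ {w} → w ∈ Q → promotion P L w ≡ L w ∸ 1
      shifted {w} w∈Q with promotion-view L w
      ... | off-chain _ eq     = eq
      ... | chain-step on _ _  = contradiction on (lower-ideal-off-chain (≤-<-trans (s≤s z≤n) ∘ labels>t) w∈Q)
      ... | chain-top on _ _   = contradiction on (lower-ideal-off-chain (≤-<-trans (s≤s z≤n) ∘ labels>t) w∈Q)
      shifted>t : ∀ {w} → w ∈ Q → t < promotion P L w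
      shifted>t w∈Q = subst (t <_) (sym (shifted w∈Q)) (1+<⇒<∸1 (labels>t w∈Q))

  module _ {c : ℕ} (M : Labeling P) (sorted : SortedAbove c (lab M)) where

    private
      labelAtMost? : Decidable (λ z → lab M z ≤ c)
      labelAtMost? z = lab M z ≤? c
      Q = subset labelAtMost?

    sortedAbove-lower-ideal : IsLowerOrderIdeal P Q
    sortedAbove-lower-ideal z z′ z∈Q z′≤z = ∈-subset⁺ labelAtMost? (≮⇒≥ λ c<Mz′ →
      <⇒≱ c<Mz′ (≤-trans (sorted z′≤z c<Mz′) (∈-subset⁻ labelAtMost? z∈Q)))

    sortedAbove-inversion-below : ∀ {x y} → x ≤P y → lab M y < lab M x → lab M x ≤ c
    sortedAbove-inversion-below x≤y My<Mx = ≮⇒≥ λ c<Mx → <⇒≱ My<Mx (sorted x≤y c<Mx)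

    sortedAbove-inversion⇒ideal : c ≤ n → ∀ {x y} → x ≤P y → lab M y < lab M x →
      Σ (Subset n) (λ Q → IsLowerOrderIdeal P Q × (∣ Q ∣ ≡ c) × ¬ IsAntichain P Q)
    sortedAbove-inversion⇒ideal c≤n {x} {y} x≤y My<Mx =
      Q , sortedAbove-lower-ideal , ∣labels≤c∣≡c M c≤n , λ antichain →
        <-irrefl (cong (lab M) (sym (antichain x y x∈Q y∈Q x≤y))) My<Mx
      where
      Mx≤c = sortedAbove-inversion-below x≤y My<Mx
      x∈Q = ∈-subset⁺ labelAtMost? Mx≤c
      y∈Q = ∈-subset⁺ labelAtMost? (≤-trans (<⇒≤ My<Mx) Mx≤c)

  sortedAbove-after-promotions : ∀ {c} (L : Labeling P) → c ≤ n → SortedAbove c (lab (promoteⁿ (n ∸ c) L))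
  sortedAbove-after-promotions {c} L c≤n = promoteⁿ-sortedAbove (n ∸ c) L
    (subst (λ m → SortedAbove m (lab L)) (sym (m∸n+n≡m c≤n)) (labeling-sortedAbove-n L))

  untangled⇒ideal : ∀ {c} (L : Labeling P) → c ≤ n → ¬ IsLinearExtension P (iterate P (n ∸ c) (lab L)) →
    Σ (Subset n) (λ Q → IsLowerOrderIdeal P Q × (∣ Q ∣ ≡ c) × ¬ IsAntichain P Q)
  untangled⇒ideal {c} L c≤n nonlinear =
    let x , y , x≤y , Mx≰My = ¬∀⇒∃¬₂ (λ x y → x ≤P? y) (λ x y → lab M x ≤? lab M y) nonlinear′
    in sortedAbove-inversion⇒ideal M (sortedAbove-after-promotions L c≤n) c≤n x≤y (≰⇒> Mx≰My)
    where
    M = promoteⁿ (n ∸ c) L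
    nonlinear′ : ¬ (∀ x y → x ≤P y → lab M x ≤ lab M y)
    nonlinear′ = subst (λ M → ¬ IsLinearExtension P M) (sym (lab-promoteⁿ (n ∸ c) L)) nonlinear

  nonAntichain⇒comparable : ∀ {Q} → ¬ IsAntichain P Q → ∃₂ λ a b → (a ∈ Q × b ∈ Q × a ≤P b) × a ≢ b
  nonAntichain⇒comparable {Q} ¬antichain =
    ¬∀⇒∃¬₂ (λ a b → a ∈? Q ×-dec b ∈? Q ×-dec a ≤P? b) (λ a b → a Fin.≟ b)
      λ antichain → ¬antichain λ a b a∈Q b∈Q a≤b → antichain a b (a∈Q , b∈Q , a≤b)

  module _ {c} {Q : Subset n} (Q-lower : IsLowerOrderIdeal P Q) (∣Q∣≡c : ∣ Q ∣ ≡ c) {b : Fin n} where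

    private
      key = tieredKey (tier Q b)

    rank-on-ideal : ∀ {z} → z ∈ Q → n ∸ c < rank key z
    rank-on-ideal {z} z∈Q = s≤s (begin
      n ∸ c                ≡⟨ cong (n ∸_) ∣Q∣≡c ⟨
      n ∸ ∣ Q ∣            ≡⟨ ∣∁p∣≡n∸∣p∣ Q ⟨
      ∣ ∁ Q ∣              ≤⟨ p⊆q⇒∣p∣≤∣q∣ ∁Q⊆keysBelow ⟩
      ∣ keysBelow key z ∣  ∎)
      where
      open ≤-Reasoning
      ∁Q⊆keysBelow : ∁ Q ⊆ keysBelow key z
      ∁Q⊆keysBelow {w} w∈∁Q = ∈-subset⁺ (λ w → key w <? key z) (tieredKey-mono (tier Q b)
        (subst (_< tier Q b z) (sym (tier-outside Q b (x∈∁p⇒x∉p w∈∁Q))) (tier-inside Q b z∈Q)))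

    rank-inverts : ∀ {a} → a ∈ Q → b ∈ Q → a ≤P b → a ≢ b → ¬ IsLinearExtension P (iterate P (n ∸ c) (rank key))
    rank-inverts {a} a∈Q b∈Q a≤b a≢b linear = <⇒≱ Mb<Ma (linear a b a≤b)
      where
      open ≤-Reasoning
      M = iterate P (n ∸ c) (rank key)
      rank-b<rank-a : rank key b < rank key a
      rank-b<rank-a = rank-mono key {b} {a} (tieredKey-mono (tier Q b) (tier-b<tier Q b a∈Q b∈Q a≢b))
      Mb<Ma : M b < M a
      Mb<Ma = begin-strict
        M b                    ≡⟨ iterate-on-lower-ideal Q-lower (n ∸ c) rank-on-ideal b∈Q ⟩
        rank key b ∸ (n ∸ c)   <⟨ ∸-monoˡ-< rank-b<rank-a (<⇒≤ (rank-on-ideal b∈Q)) ⟩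
        rank key a ∸ (n ∸ c)   ≡⟨ iterate-on-lower-ideal Q-lower (n ∸ c) rank-on-ideal a∈Q ⟨
        M a                    ∎

  ideal⇒untangled : ∀ {c Q} → IsLowerOrderIdeal P Q → ∣ Q ∣ ≡ c → ¬ IsAntichain P Q →
    Σ (Labeling P) λ L → ¬ IsLinearExtension P (iterate P (n ∸ c) (lab L))
  ideal⇒untangled {Q = Q} Q-lower ∣Q∣≡c ¬antichain =
    let a , b , (a∈Q , b∈Q , a≤b) , a≢b = nonAntichain⇒comparable ¬antichain
    in rankLabeling (tieredKey (tier Q b)) (tieredKey-injective (tier Q b)) ,
       rank-inverts Q-lower ∣Q∣≡c a∈Q b∈Q a≤b a≢b

theorem2p10 : (n k : ℕ) (P : FinPoset n) → k + 2 ≤ n →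
    (Σ (Labeling P) (λ L → Untangled P k L)) ⇔
    (Σ (Subset n) (λ Q → IsLowerOrderIdeal P Q × (∣ Q ∣ ≡ k + 2) × ¬ IsAntichain P Q))
theorem2p10 n k P k+2≤n = mk⇔
  (λ (L , _ , nonlinear) → untangled⇒ideal P L k+2≤n nonlinear)
  (λ (Q , Q-lower , ∣Q∣≡k+2 , ¬antichain) →
    let L , nonlinear = ideal⇒untangled P Q-lower ∣Q∣≡k+2 ¬antichain in L , k+2≤n , nonlinear)
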